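{- Let $n,r$ be positive integers, $K_r=2^{2r}-2^r+1$, and $a,s\in\{1,\dots,2^n-2\}$ with binary expansions $a=\sum_{i=0}^{n-1}a_i2^i$ and $s=\sum_{i=0}^{n-1}s_i2^i$. The following are equivalent: (a) $s\equiv K_r\cdot a\pmod{2^n-1}$; (b) there exists a sequence $(c_{n-1},\dots,c_0)$ with $c_i\in\{ -1,0,1\}$ such that $2c_i-c_{i-1}+s_i=a_{i-2r}-a_{i-r}+a_i$ for all $i$, where indices are taken modulo $n$. Moreover, the sequence $c$ in (b) is unique. -}

module Defs where

open import Data.Nat as ℕ using (ℕ; zero; suc; _∸_; _^_; NonZero)
open import Data.Nat.DivMod using (_/_; _%_; _mod_)
open import Data.Fin using (Fin; toℕ)
open import Data.Integer as ℤ using (ℤ; +_; -[1+_])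
open import Data.Integer.Divisibility using (_∣_)
open import Data.Sum using (_⊎_)
open import Data.Product using (_×_)
open import Relation.Binary.PropositionalEquality using (_≡_)

bit : ℕ → ℕ → ℕ
bit a zero    = a % 2
bit a (suc i) = bit (a / 2) i

K : ℕ → ℕ
K r = (2 ^ (2 ℕ.* r)) ∸ (2 ^ r) ℕ.+ 1

-- i - k, taken modulo n, as an element of Fin n
minus : ∀ {n} .{{_ : NonZero n}} → Fin n → ℕ → Fin n
minus {n} i k = (toℕ i ℕ.+ (n ∸ (k % n))) mod n

CongK : (n r a s : ℕ) → Set
CongK n r a s = (+ (2 ^ n) ℤ.- + 1) ∣ (+ s ℤ.- + (K r ℕ.* a))

Digit : ℤ → Set
Digit x = x ≡ -[1+ 0 ] ⊎ (x ≡ + 0 ⊎ x ≡ + 1)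

Carry : (n r a s : ℕ) .{{_ : NonZero n}} → (Fin n → ℤ) → Set
Carry n r a s c =
  (∀ i → Digit (c i)) ×
  (∀ (i : Fin n) →
     (+ 2) ℤ.* c i ℤ.- c (minus i 1) ℤ.+ + (bit s (toℕ i))
       ≡ + (bit a (toℕ (minus i (2 ℕ.* r)))) ℤ.- + (bit a (toℕ (minus i r))) ℤ.+ + (bit a (toℕ i)))

-- Write rhs_i = a_{i−2r} − a_{i−r} + a_i − s_i. Rotating an n-bit expansion by k places
-- multiplies its value by 2^k modulo 2^n − 1, so Σ rhs_i 2^i ≡ K_r a − s, and for the same
-- reason Σ (2c_i − c_{i−1}) 2^i ≡ 0 for every cyclic sequence c; this gives (b) ⇒ (a).
-- Conversely, if Σ rhs_i 2^i = k (2^n − 1), the bounds a, s ≤ 2^n − 2 force k ∈ {−1, 0, 1},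
-- and the carries are read off the partial sums, 2^{j+1} c_j = k + Σ_{i≤j} rhs_i 2^i; a size
-- estimate shows that they are digits again. Two solutions differ by d with d_{i−1} = 2 d_i,
-- hence d_i = 4 d_{i+2}, which forces d = 0 for differences of digits.

module Submission where

open import Defs
open import Data.Nat using (ℕ; _≤_; _∸_; _^_; NonZero)
open import Data.Fin using (Fin)
open import Data.Integer using (ℤ)
open import Data.Product using (_×_; ∃)
open import Function.Bundles using (_⇔_)
open import Relation.Binary.PropositionalEquality using (_≡_)

open import Data.Nat as ℕ using (zero; suc; z≤n; s≤s; _<_)
import Data.Nat.Properties as ℕP
open import Data.Nat.DivMod
  using (_/_; _%_; _mod_; m%n<n; m<n⇒m%n≡m; m≡m%n+[m/n]*n; m<n*o⇒m/o<n;
         %-distribˡ-+; [m+n]%n≡m%n; m%n%n≡m%n; n%1≡0; n%n≡0)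
open import Data.Fin using (toℕ)
import Data.Fin.Properties as FinP
open import Data.Integer as ℤ using (+_; -[1+_]; +[1+_]; _+_; _*_; -_; _-_)
import Data.Integer.Properties as ℤP
open import Data.Integer.Divisibility.Signed as Signed using (divides; ∣ᵤ⇒∣; ∣⇒∣ᵤ)
open import Data.Integer.Tactic.RingSolver using (solve-∀)
open import Data.Product using (_,_)
open import Data.Sum using (inj₁; inj₂)
open import Data.Empty using (⊥-elim)
open import Function.Base using (_∘_)
open import Function.Bundles using (mk⇔)
open import Level using (0ℓ)
open import Relation.Binary.Bundles using (Setoid)
import Relation.Binary.Reasoning.Setoid
open import Algebra.Properties.AbelianGroup ℤP.+-0-abelianGroup
  using () renaming (∙-cancelʳ to +-cancelʳ)
open import Relation.Binary.PropositionalEquality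
  using (refl; sym; trans; cong; cong₂; subst; module ≡-Reasoning)

pos-∸ : ∀ {m n} → m ≤ n → + (n ∸ m) ≡ + n - + m
pos-∸ {m} {n} m≤n = sym (trans (ℤP.m-n≡m⊖n n m) (ℤP.⊖-≥ m≤n))

x≡y-z⇒x+z≡y : ∀ {x y z} → x ≡ y - z → x + z ≡ y
x≡y-z⇒x+z≡y {x} {y} {z} eq = trans (cong (_+ z) eq) (cancel y z)
  where
  cancel : ∀ y z → y - z + z ≡ y
  cancel = solve-∀

x+z≡y⇒x≡y-z : ∀ {x y z} → x + z ≡ y → x ≡ y - z
x+z≡y⇒x≡y-z {x} {y} {z} eq = trans (cancel x z) (cong (_- z) eq)
  where
  cancel : ∀ x z → x ≡ x + z - z
  cancel = solve-∀

+x≡+p-+n⇒x+n≡p : ∀ {x p n} → + x ≡ + p - + n → x ℕ.+ n ≡ p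
+x≡+p-+n⇒x+n≡p {n = n} eq = ℤP.+-injective (x≡y-z⇒x+z≡y {z = + n} eq)

m+n<2*o : ∀ {m n o} → m ≤ o → n < o → m ℕ.+ n < 2 ℕ.* o
m+n<2*o {m} {n} {o} m≤o n<o = begin-strict
  m ℕ.+ n   <⟨ ℕP.+-mono-≤-< m≤o n<o ⟩
  o ℕ.+ o   ≡⟨ cong (o ℕ.+_) (ℕP.+-identityʳ o) ⟨
  2 ℕ.* o ∎
  where open ℕP.≤-Reasoning

[m%n+k]%n≡[m+k]%n : ∀ m k n .{{_ : NonZero n}} → (m % n ℕ.+ k) % n ≡ (m ℕ.+ k) % n
[m%n+k]%n≡[m+k]%n m k n = begin
  (m % n ℕ.+ k) % n           ≡⟨ %-distribˡ-+ (m % n) k n ⟩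
  (m % n % n ℕ.+ k % n) % n   ≡⟨ cong (λ z → (z ℕ.+ k % n) % n) (m%n%n≡m%n m n) ⟩
  (m % n ℕ.+ k % n) % n       ≡⟨ %-distribˡ-+ m k n ⟨
  (m ℕ.+ k) % n ∎
  where open ≡-Reasoning

pow2 : ℕ → ℤ
pow2 m = + (2 ^ m)

pow2-suc : ∀ m → pow2 (suc m) ≡ + 2 * pow2 m
pow2-suc m = ℤP.pos-* 2 (2 ^ m)

pow2-+ : ∀ m k → pow2 (m ℕ.+ k) ≡ pow2 m * pow2 k
pow2-+ m k = trans (cong +_ (ℕP.^-distribˡ-+-* 2 m k)) (ℤP.pos-* (2 ^ m) (2 ^ k))

binSum : ℕ → (ℕ → ℤ) → ℤ
binSum zero    f = + 0
binSum (suc m) f = f 0 + + 2 * binSum m (f ∘ suc)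

binSum-split : ∀ m k f → binSum (m ℕ.+ k) f ≡ binSum m f + pow2 m * binSum k (λ j → f (m ℕ.+ j))
binSum-split zero    k f = sym (trans (ℤP.+-identityˡ _) (ℤP.*-identityˡ _))
binSum-split (suc m) k f = begin
  f 0 + + 2 * binSum (m ℕ.+ k) (f ∘ suc)
    ≡⟨ cong (λ z → f 0 + + 2 * z) (binSum-split m k (f ∘ suc)) ⟩
  f 0 + + 2 * (binSum m (f ∘ suc) + pow2 m * T)
    ≡⟨ distrib (f 0) (binSum m (f ∘ suc)) (pow2 m) T ⟩
  binSum (suc m) f + (+ 2 * pow2 m) * T
    ≡⟨ cong (λ z → binSum (suc m) f + z * T) (sym (pow2-suc m)) ⟩
  binSum (suc m) f + pow2 (suc m) * T ∎
  where
  open ≡-Reasoning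
  T : ℤ
  T = binSum k (λ j → f (suc m ℕ.+ j))
  distrib : ∀ u v p t → u + + 2 * (v + p * t) ≡ (u + + 2 * v) + (+ 2 * p) * t
  distrib = solve-∀

binSum-last : ∀ m f → binSum (suc m) f ≡ binSum m f + pow2 m * f m
binSum-last m f = begin
  binSum (suc m) f        ≡⟨ cong (λ k → binSum k f) (ℕP.+-comm 1 m) ⟩
  binSum (m ℕ.+ 1) f      ≡⟨ binSum-split m 1 f ⟩
  binSum m f + pow2 m * (f (m ℕ.+ 0) + + 2 * + 0)
    ≡⟨ cong (λ z → binSum m f + pow2 m * z) (trans (ℤP.+-identityʳ _) (cong f (ℕP.+-identityʳ m))) ⟩
  binSum m f + pow2 m * f m ∎
  where open ≡-Reasoning

binSum-cong : ∀ m {f g} → (∀ j → j < m → f j ≡ g j) → binSum m f ≡ binSum m g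
binSum-cong zero    f≡g = refl
binSum-cong (suc m) f≡g =
  cong₂ (λ u v → u + + 2 * v) (f≡g 0 (s≤s z≤n)) (binSum-cong m (λ j j<m → f≡g (suc j) (s≤s j<m)))

binSum-+ : ∀ m f g → binSum m (λ j → f j + g j) ≡ binSum m f + binSum m g
binSum-+ zero    f g = refl
binSum-+ (suc m) f g =
  trans (cong (λ z → (f 0 + g 0) + + 2 * z) (binSum-+ m (f ∘ suc) (g ∘ suc)))
        (interchange (f 0) (g 0) (binSum m (f ∘ suc)) (binSum m (g ∘ suc)))
  where
  interchange : ∀ u v x y → (u + v) + + 2 * (x + y) ≡ (u + + 2 * x) + (v + + 2 * y)
  interchange = solve-∀

binSum-*ˡ : ∀ m u f → binSum m (λ j → u * f j) ≡ u * binSum m f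
binSum-*ˡ zero    u f = sym (ℤP.*-zeroʳ u)
binSum-*ˡ (suc m) u f =
  trans (cong (λ z → u * f 0 + + 2 * z) (binSum-*ˡ m u (f ∘ suc)))
        (factor u (f 0) (binSum m (f ∘ suc)))
  where
  factor : ∀ u v x → u * v + + 2 * (u * x) ≡ u * (v + + 2 * x)
  factor = solve-∀

binSum-neg : ∀ m f → binSum m (λ j → - f j) ≡ - binSum m f
binSum-neg m f = begin
  binSum m (λ j → - f j)       ≡⟨ binSum-cong m (λ j _ → sym (ℤP.-1*i≡-i (f j))) ⟩
  binSum m (λ j → ℤ.-1ℤ * f j)  ≡⟨ binSum-*ˡ m ℤ.-1ℤ f ⟩
  ℤ.-1ℤ * binSum m f            ≡⟨ ℤP.-1*i≡-i (binSum m f) ⟩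
  - binSum m f ∎
  where open ≡-Reasoning

binSum-- : ∀ m f g → binSum m (λ j → f j - g j) ≡ binSum m f - binSum m g
binSum-- m f g = trans (binSum-+ m f (λ j → - g j)) (cong (λ z → binSum m f + z) (binSum-neg m g))

bit<2 : ∀ a j → bit a j < 2
bit<2 a zero    = m%n<n a 2
bit<2 a (suc j) = bit<2 (a / 2) j

binVal : ℕ → (ℕ → ℕ) → ℕ
binVal zero    b = 0
binVal (suc m) b = b 0 ℕ.+ 2 ℕ.* binVal m (b ∘ suc)

binSum-pos : ∀ m b → binSum m (λ j → + b j) ≡ + binVal m b
binSum-pos zero    b = refl
binSum-pos (suc m) b = begin
  + b 0 + + 2 * binSum m (λ j → + b (suc j)) ≡⟨ cong (λ z → + b 0 + + 2 * z) (binSum-pos m (b ∘ suc)) ⟩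
  + b 0 + + 2 * + binVal m (b ∘ suc)         ≡⟨ cong (λ z → + b 0 + z) (ℤP.pos-* 2 (binVal m (b ∘ suc))) ⟨
  + (b 0 ℕ.+ 2 ℕ.* binVal m (b ∘ suc)) ∎
  where open ≡-Reasoning

binVal<2^ : ∀ m b → (∀ j → b j < 2) → binVal m b < 2 ^ m
binVal<2^ zero    b b<2 = s≤s z≤n
binVal<2^ (suc m) b b<2 = begin-strict
  b 0 ℕ.+ 2 ℕ.* V   <⟨ ℕP.+-monoˡ-< (2 ℕ.* V) (b<2 0) ⟩
  2 ℕ.+ 2 ℕ.* V     ≡⟨ ℕP.*-suc 2 V ⟨
  2 ℕ.* suc V       ≤⟨ ℕP.*-monoʳ-≤ 2 (binVal<2^ m (b ∘ suc) (b<2 ∘ suc)) ⟩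
  2 ℕ.* 2 ^ m ∎
  where
  open ℕP.≤-Reasoning
  V : ℕ
  V = binVal m (b ∘ suc)

binVal-bit : ∀ m a → a < 2 ^ m → binVal m (bit a) ≡ a
binVal-bit zero    zero    _        = refl
binVal-bit zero    (suc a) (s≤s ())
binVal-bit (suc m) a       a<2^1+m = begin
  a % 2 ℕ.+ 2 ℕ.* binVal m (bit (a / 2))  ≡⟨ cong (λ z → a % 2 ℕ.+ 2 ℕ.* z) (binVal-bit m (a / 2) a/2<2^m) ⟩
  a % 2 ℕ.+ 2 ℕ.* (a / 2)                 ≡⟨ cong (a % 2 ℕ.+_) (ℕP.*-comm 2 (a / 2)) ⟩
  a % 2 ℕ.+ a / 2 ℕ.* 2                   ≡⟨ m≡m%n+[m/n]*n a 2 ⟨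
  a ∎
  where
  open ≡-Reasoning
  a/2<2^m : a / 2 < 2 ^ m
  a/2<2^m = m<n*o⇒m/o<n (subst (a <_) (ℕP.*-comm 2 (2 ^ m)) a<2^1+m)

binSum-bit : ∀ m a → a < 2 ^ m → binSum m (λ j → + bit a j) ≡ + a
binSum-bit m a a<2^m = trans (binSum-pos m (bit a)) (cong +_ (binVal-bit m a a<2^m))

module Congruence (M : ℤ) where

  infix 4 _≈_
  record _≈_ (x y : ℤ) : Set where
    constructor mk≈
    field divisible : M Signed.∣ x - y

  ≈-reflexive : ∀ {x y} → x ≡ y → x ≈ y
  ≈-reflexive {x} refl = mk≈ (divides (+ 0) (x-x≡0*M x M))
    where
    x-x≡0*M : ∀ x M → x - x ≡ + 0 * M
    x-x≡0*M = solve-∀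

  ≈-sym : ∀ {x y} → x ≈ y → y ≈ x
  ≈-sym {x} {y} (mk≈ x≈y) = mk≈ (subst (M Signed.∣_) (negate x y) (Signed.∣m⇒∣-m x≈y))
    where
    negate : ∀ x y → - (x - y) ≡ y - x
    negate = solve-∀

  ≈-trans : ∀ {x y z} → x ≈ y → y ≈ z → x ≈ z
  ≈-trans {x} {y} {z} (mk≈ x≈y) (mk≈ y≈z) =
    mk≈ (subst (M Signed.∣_) (telescope x y z) (Signed.∣m∣n⇒∣m+n x≈y y≈z))
    where
    telescope : ∀ x y z → (x - y) + (y - z) ≡ x - z
    telescope = solve-∀

  +-cong : ∀ {x x′ y y′} → x ≈ x′ → y ≈ y′ → x + y ≈ x′ + y′
  +-cong {x} {x′} {y} {y′} (mk≈ x≈x′) (mk≈ y≈y′) =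
    mk≈ (subst (M Signed.∣_) (interchange x x′ y y′) (Signed.∣m∣n⇒∣m+n x≈x′ y≈y′))
    where
    interchange : ∀ x x′ y y′ → (x - x′) + (y - y′) ≡ (x + y) - (x′ + y′)
    interchange = solve-∀

  *-cong : ∀ {x x′ y y′} → x ≈ x′ → y ≈ y′ → x * y ≈ x′ * y′
  *-cong {x} {x′} {y} {y′} (mk≈ x≈x′) (mk≈ y≈y′) =
    mk≈ (subst (M Signed.∣_) (expand x x′ y y′)
               (Signed.∣m∣n⇒∣m+n (Signed.∣n⇒∣m*n x y≈y′) (Signed.∣m⇒∣m*n y′ x≈x′)))
    where
    expand : ∀ x x′ y y′ → x * (y - y′) + (x - x′) * y′ ≡ x * y - x′ * y′
    expand = solve-∀

  *-congˡ : ∀ x {y y′} → y ≈ y′ → x * y ≈ x * y′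
  *-congˡ x = *-cong (≈-reflexive {x} refl)

  *-congʳ : ∀ y {x x′} → x ≈ x′ → x * y ≈ x′ * y
  *-congʳ y x≈x′ = *-cong x≈x′ (≈-reflexive {y} refl)

  +-congˡ : ∀ x {y y′} → y ≈ y′ → x + y ≈ x + y′
  +-congˡ x = +-cong (≈-reflexive {x} refl)

  neg-cong : ∀ {x x′} → x ≈ x′ → - x ≈ - x′
  neg-cong {x} {x′} (mk≈ x≈x′) = mk≈ (subst (M Signed.∣_) (negate x x′) (Signed.∣m⇒∣-m x≈x′))
    where
    negate : ∀ x x′ → - (x - x′) ≡ - x - - x′
    negate = solve-∀

  ≈-setoid : Setoid 0ℓ 0ℓ
  ≈-setoid = record
    { Carrier       = ℤ
    ; _≈_           = _≈_
    ; isEquivalence = record { refl = ≈-reflexive refl ; sym = ≈-sym ; trans = ≈-trans }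
    }

  module ≈-Reasoning = Relation.Binary.Reasoning.Setoid ≈-setoid

  multiple≈0 : ∀ k → k * M ≈ + 0
  multiple≈0 k = mk≈ (divides k (ℤP.+-identityʳ (k * M)))

-- Cyclic shifts of n-bit expansions

toℕ-minus-1 : ∀ m (i : Fin (suc m)) → toℕ (minus i 1) ≡ (toℕ i ℕ.+ m) % suc m
-- For n = 1 the offset n ∸ 1 % n is 1 rather than m = 0; both sides vanish modulo 1.
toℕ-minus-1 zero    i = trans (FinP.toℕ-fromℕ< (m%n<n (toℕ i ℕ.+ 1) 1))
                              (trans (n%1≡0 (toℕ i ℕ.+ 1)) (sym (n%1≡0 (toℕ i ℕ.+ 0))))
toℕ-minus-1 (suc m) i = FinP.toℕ-fromℕ< (m%n<n (toℕ i ℕ.+ suc m) (suc (suc m)))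

module Cyclic (m : ℕ) where

  n : ℕ
  n = suc m

  M : ℤ
  M = pow2 n - + 1

  open Congruence M

  pow2-n≈1 : pow2 n ≈ + 1
  pow2-n≈1 = mk≈ (divides (+ 1) (sym (ℤP.*-identityˡ M)))

  pow2-*n≈1 : ∀ q → pow2 (q ℕ.* n) ≈ + 1
  pow2-*n≈1 zero    = ≈-reflexive refl
  pow2-*n≈1 (suc q) = begin
    pow2 (n ℕ.+ q ℕ.* n)     ≡⟨ pow2-+ n (q ℕ.* n) ⟩
    pow2 n * pow2 (q ℕ.* n)  ≈⟨ *-cong pow2-n≈1 (pow2-*n≈1 q) ⟩
    + 1 * + 1                ≡⟨⟩
    + 1 ∎
    where open ≈-Reasoning

  pow2≈pow2-% : ∀ k → pow2 k ≈ pow2 (k % n)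
  pow2≈pow2-% k = begin
    pow2 k                                   ≡⟨ cong pow2 (m≡m%n+[m/n]*n k n) ⟩
    pow2 (k % n ℕ.+ k / n ℕ.* n)             ≡⟨ pow2-+ (k % n) (k / n ℕ.* n) ⟩
    pow2 (k % n) * pow2 (k / n ℕ.* n)        ≈⟨ *-congˡ (pow2 (k % n)) (pow2-*n≈1 (k / n)) ⟩
    pow2 (k % n) * + 1                       ≡⟨ ℤP.*-identityʳ (pow2 (k % n)) ⟩
    pow2 (k % n) ∎
    where open ≈-Reasoning

  rotate : ℕ → ℕ → ℕ
  rotate t j = (j ℕ.+ t) % n

  rotate-rotate₁ : ∀ t j → rotate t (rotate 1 j) ≡ rotate (suc t) j
  rotate-rotate₁ t j = trans ([m%n+k]%n≡[m+k]%n (j ℕ.+ 1) t n) (cong (_% n) (ℕP.+-assoc j 1 t))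

  binSum-rotate₁ : ∀ g → + 2 * binSum n (g ∘ rotate 1) ≈ binSum n g
  binSum-rotate₁ g = begin
    + 2 * binSum n (g ∘ rotate 1)
      ≡⟨ cong (+ 2 *_) (binSum-last m (g ∘ rotate 1)) ⟩
    + 2 * (binSum m (g ∘ rotate 1) + pow2 m * g (rotate 1 m))
      ≡⟨ cong₂ (λ u v → + 2 * (u + pow2 m * g v)) low-digits wrap-around ⟩
    + 2 * (binSum m (g ∘ suc) + pow2 m * g 0)
      ≡⟨ regroup (binSum m (g ∘ suc)) (pow2 m) (g 0) ⟩
    binSum n g + g 0 * (+ 2 * pow2 m - + 1)
      ≡⟨ cong (λ z → binSum n g + g 0 * (z - + 1)) (pow2-suc m) ⟨
    binSum n g + g 0 * M
      ≈⟨ +-congˡ (binSum n g) (multiple≈0 (g 0)) ⟩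
    binSum n g + + 0
      ≡⟨ ℤP.+-identityʳ (binSum n g) ⟩
    binSum n g ∎
    where
    open ≈-Reasoning
    low-digits : binSum m (g ∘ rotate 1) ≡ binSum m (g ∘ suc)
    low-digits = binSum-cong m (λ j j<m →
      cong g (trans (cong (_% n) (ℕP.+-comm j 1)) (m<n⇒m%n≡m (s≤s j<m))))
    wrap-around : rotate 1 m ≡ 0
    wrap-around = trans (cong (_% n) (ℕP.+-comm m 1)) (n%n≡0 n)
    regroup : ∀ A P G → + 2 * (A + P * G) ≡ (G + + 2 * A) + G * (+ 2 * P - + 1)
    regroup = solve-∀

  binSum-rotate : ∀ t g → pow2 t * binSum n (g ∘ rotate t) ≈ binSum n g
  binSum-rotate zero g = ≈-reflexive (trans (ℤP.*-identityˡ _) (binSum-cong n (λ j j<n →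
    cong g (trans (cong (_% n) (ℕP.+-identityʳ j)) (m<n⇒m%n≡m j<n)))))
  binSum-rotate (suc t) g = begin
    pow2 (suc t) * binSum n (g ∘ rotate (suc t))
      ≡⟨ cong₂ _*_ (pow2-suc t) (binSum-cong n (λ j _ → cong g (sym (rotate-rotate₁ t j)))) ⟩
    (+ 2 * pow2 t) * binSum n (g ∘ rotate t ∘ rotate 1)
      ≡⟨ shuffle (pow2 t) _ ⟩
    pow2 t * (+ 2 * binSum n (g ∘ rotate t ∘ rotate 1))
      ≈⟨ *-congˡ (pow2 t) (binSum-rotate₁ (g ∘ rotate t)) ⟩
    pow2 t * binSum n (g ∘ rotate t)
      ≈⟨ binSum-rotate t g ⟩
    binSum n g ∎
    where
    open ≈-Reasoning
    shuffle : ∀ P X → (+ 2 * P) * X ≡ P * (+ 2 * X)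
    shuffle = solve-∀

  toℕ-minus : ∀ j k → toℕ (minus (j mod n) k) ≡ rotate (n ∸ k % n) j
  toℕ-minus j k = begin
    toℕ (minus (j mod n) k)              ≡⟨ FinP.toℕ-fromℕ< (m%n<n (toℕ (j mod n) ℕ.+ (n ∸ k % n)) n) ⟩
    (toℕ (j mod n) ℕ.+ (n ∸ k % n)) % n  ≡⟨ cong (λ z → (z ℕ.+ (n ∸ k % n)) % n) (FinP.toℕ-fromℕ< (m%n<n j n)) ⟩
    (j % n ℕ.+ (n ∸ k % n)) % n          ≡⟨ [m%n+k]%n≡[m+k]%n j (n ∸ k % n) n ⟩
    rotate (n ∸ k % n) j ∎
    where open ≡-Reasoning

  binSum-minus : ∀ k g → binSum n (λ j → g (toℕ (minus (j mod n) k))) ≈ pow2 k * binSum n g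
  binSum-minus k g = begin
    binSum n (λ j → g (toℕ (minus (j mod n) k)))
      ≡⟨ binSum-cong n (λ j _ → cong g (toℕ-minus j k)) ⟩
    X
      ≡⟨ ℤP.*-identityˡ X ⟨
    + 1 * X
      ≈⟨ *-congʳ X pow2-n≈1 ⟨
    pow2 n * X
      ≡⟨ cong (λ z → pow2 z * X) (ℕP.m+[n∸m]≡n (ℕP.<⇒≤ (m%n<n k n))) ⟨
    pow2 (k % n ℕ.+ t) * X
      ≡⟨ trans (cong (_* X) (pow2-+ (k % n) t)) (ℤP.*-assoc (pow2 (k % n)) (pow2 t) X) ⟩
    pow2 (k % n) * (pow2 t * X)
      ≈⟨ *-cong (≈-sym (pow2≈pow2-% k)) (binSum-rotate t g) ⟩
    pow2 k * binSum n g ∎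
    where
    open ≈-Reasoning
    t : ℕ
    t = n ∸ k % n
    X : ℤ
    X = binSum n (g ∘ rotate t)

  [1+j+m]%n≡j : ∀ j → j < n → (suc j ℕ.+ m) % n ≡ j
  [1+j+m]%n≡j j j<n = begin
    (suc j ℕ.+ m) % n  ≡⟨ cong (_% n) (ℕP.+-suc j m) ⟨
    (j ℕ.+ n) % n      ≡⟨ [m+n]%n≡m%n j n ⟩
    j % n              ≡⟨ m<n⇒m%n≡m j<n ⟩
    j ∎
    where open ≡-Reasoning

  successor : Fin n → Fin n
  successor i = suc (toℕ i) mod n

  minus-1-successor : ∀ i → minus (successor i) 1 ≡ i
  minus-1-successor i = FinP.toℕ-injective (begin
    toℕ (minus (successor i) 1)        ≡⟨ toℕ-minus-1 m (successor i) ⟩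
    (toℕ (successor i) ℕ.+ m) % n      ≡⟨ cong (λ z → (z ℕ.+ m) % n) (FinP.toℕ-fromℕ< (m%n<n (suc (toℕ i)) n)) ⟩
    (suc (toℕ i) % n ℕ.+ m) % n        ≡⟨ [m%n+k]%n≡[m+k]%n (suc (toℕ i)) m n ⟩
    (suc (toℕ i) ℕ.+ m) % n            ≡⟨ [1+j+m]%n≡j (toℕ i) (FinP.toℕ<n i) ⟩
    toℕ i ∎)
    where open ≡-Reasoning

2*B≤p : ∀ w B {p n} → + suc (suc w) * + B ≡ + p - + n → 2 ℕ.* B ≤ p
2*B≤p w B {p} {n} eq = begin
  2 ℕ.* B                 ≤⟨ ℕP.*-monoˡ-≤ B {2} {suc (suc w)} (s≤s (s≤s z≤n)) ⟩
  suc (suc w) ℕ.* B       ≤⟨ ℕP.m≤m+n _ n ⟩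
  suc (suc w) ℕ.* B ℕ.+ n ≡⟨ +x≡+p-+n⇒x+n≡p (trans (ℤP.pos-* (suc (suc w)) B) eq) ⟩
  p ∎
  where open ℕP.≤-Reasoning

digit-from-bounds : ∀ q B p n → q * + B ≡ + p - + n → p < 2 ℕ.* B → n < 2 ℕ.* B → Digit q
digit-from-bounds (+ 0)         _ _ _ _  _     _     = inj₂ (inj₁ refl)
digit-from-bounds (+ 1)         _ _ _ _  _     _     = inj₂ (inj₂ refl)
digit-from-bounds -[1+ 0 ]      _ _ _ _  _     _     = inj₁ refl
digit-from-bounds +[1+ suc w ]  B p n eq p<2B  _     = ⊥-elim (ℕP.<⇒≱ p<2B (2*B≤p w B {n = n} eq))
digit-from-bounds -[1+ suc w ]  B p n eq _     n<2B  = ⊥-elim (ℕP.<⇒≱ n<2B (2*B≤p w B {n = p} eq′))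
  where
  neg-neg : ∀ q B → q * B ≡ - (- q * B)
  neg-neg = solve-∀
  neg-sub : ∀ p n → - (p - n) ≡ n - p
  neg-sub = solve-∀
  eq′ : + suc (suc w) * + B ≡ + n - + p
  eq′ = trans (neg-neg (+ suc (suc w)) (+ B)) (trans (cong -_ eq) (neg-sub (+ p) (+ n)))

digit-from-offset : ∀ k q B p n → Digit k → suc p < 2 ℕ.* B → suc n < 2 ℕ.* B →
                    q * + B ≡ k + (+ p - + n) → Digit q
digit-from-offset _ q B p n (inj₁ refl) 1+p<2B 1+n<2B eq =
  digit-from-bounds q B p (suc n) (trans eq (shift (+ p) (+ n))) (ℕP.<-trans (ℕP.n<1+n p) 1+p<2B) 1+n<2B
  where
  shift : ∀ p n → - + 1 + (p - n) ≡ p - (+ 1 + n)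
  shift = solve-∀
digit-from-offset _ q B p n (inj₂ (inj₁ refl)) 1+p<2B 1+n<2B eq =
  digit-from-bounds q B p n (trans eq (ℤP.+-identityˡ _))
    (ℕP.<-trans (ℕP.n<1+n p) 1+p<2B) (ℕP.<-trans (ℕP.n<1+n n) 1+n<2B)
digit-from-offset _ q B p n (inj₂ (inj₂ refl)) 1+p<2B 1+n<2B eq =
  digit-from-bounds q B (suc p) n (trans eq (shift (+ p) (+ n))) 1+p<2B (ℕP.<-trans (ℕP.n<1+n n) 1+n<2B)
  where
  shift : ∀ p n → + 1 + (p - n) ≡ (+ 1 + p) - n
  shift = solve-∀

∣4*z∣<4⇒z≡0 : ∀ z → ℤ.∣ + 4 * z ∣ < 4 → z ≡ + 0
∣4*z∣<4⇒z≡0 z ∣4z∣<4 = ℤP.∣i∣≡0⇒i≡0 (ℕP.n<1⇒n≡0 (ℕP.*-cancelˡ-< 4 ℤ.∣ z ∣ 1 4∣z∣<4))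
  where
  4∣z∣<4 : 4 ℕ.* ℤ.∣ z ∣ < 4 ℕ.* 1
  4∣z∣<4 = subst (_< 4) (ℤP.abs-* (+ 4) z) ∣4z∣<4

digit-distance : ∀ {x y} → Digit x → Digit y → ℤ.∣ x - y ∣ ≤ 2
digit-distance (inj₁ refl)        (inj₁ refl)        = z≤n
digit-distance (inj₁ refl)        (inj₂ (inj₁ refl)) = s≤s z≤n
digit-distance (inj₁ refl)        (inj₂ (inj₂ refl)) = s≤s (s≤s z≤n)
digit-distance (inj₂ (inj₁ refl)) (inj₁ refl)        = s≤s z≤n
digit-distance (inj₂ (inj₁ refl)) (inj₂ (inj₁ refl)) = z≤n
digit-distance (inj₂ (inj₁ refl)) (inj₂ (inj₂ refl)) = s≤s z≤n
digit-distance (inj₂ (inj₂ refl)) (inj₁ refl)        = s≤s (s≤s z≤n)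
digit-distance (inj₂ (inj₂ refl)) (inj₂ (inj₁ refl)) = s≤s z≤n
digit-distance (inj₂ (inj₂ refl)) (inj₂ (inj₂ refl)) = z≤n

digit-≡-mod-4 : ∀ {x y} z → Digit x → Digit y → x - y ≡ + 4 * z → x ≡ y
digit-≡-mod-4 {x} {y} z dx dy x-y≡4z = ℤP.i-j≡0⇒i≡j x y (begin
  x - y       ≡⟨ x-y≡4z ⟩
  + 4 * z     ≡⟨ cong (+ 4 *_) (∣4*z∣<4⇒z≡0 z ∣4z∣<4) ⟩
  + 0 ∎)
  where
  open ≡-Reasoning
  ∣4z∣<4 : ℤ.∣ + 4 * z ∣ < 4
  ∣4z∣<4 = subst (λ d → ℤ.∣ d ∣ < 4) x-y≡4z (s≤s (ℕP.≤-trans (digit-distance dx dy) (ℕP.n≤1+n 2)))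

-- Uniqueness of the carries

2*u-v≡2*u′-v′⇒v-v′≡2*[u-u′] : ∀ u v u′ v′ → + 2 * u - v ≡ + 2 * u′ - v′ → v - v′ ≡ + 2 * (u - u′)
2*u-v≡2*u′-v′⇒v-v′≡2*[u-u′] u v u′ v′ eq = ℤP.i-j≡0⇒i≡j _ _ (begin
  (v - v′) - + 2 * (u - u′)                  ≡⟨ rearrange u v u′ v′ ⟩
  - ((+ 2 * u - v) - (+ 2 * u′ - v′))        ≡⟨ cong -_ (ℤP.i≡j⇒i-j≡0 eq) ⟩
  + 0 ∎)
  where
  open ≡-Reasoning
  rearrange : ∀ u v u′ v′ → (v - v′) - + 2 * (u - u′) ≡ - ((+ 2 * u - v) - (+ 2 * u′ - v′))
  rearrange = solve-∀

carry-unique : ∀ m r a s (c c′ : Fin (suc m) → ℤ) → Carry (suc m) r a s c → Carry (suc m) r a s c′ →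
               ∀ i → c i ≡ c′ i
carry-unique m r a s c c′ (digit , eqn) (digit′ , eqn′) i =
  digit-≡-mod-4 (d i₂) (digit i) (digit′ i) (begin
    d i                  ≡⟨ d-doubles i ⟩
    + 2 * d i₁           ≡⟨ cong (+ 2 *_) (d-doubles i₁) ⟩
    + 2 * (+ 2 * d i₂)   ≡⟨ ℤP.*-assoc (+ 2) (+ 2) (d i₂) ⟨
    + 4 * d i₂ ∎)
  where
  open ≡-Reasoning
  open Cyclic m using (successor; minus-1-successor)
  d : Fin (suc m) → ℤ
  d j = c j - c′ j
  i₁ i₂ : Fin (suc m)
  i₁ = successor i
  i₂ = successor i₁
  d-doubles : ∀ j → d j ≡ + 2 * d (successor j)
  d-doubles j = subst (λ j′ → c j′ - c′ j′ ≡ + 2 * d k) (minus-1-successor j)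
    (2*u-v≡2*u′-v′⇒v-v′≡2*[u-u′] (c k) (c (minus k 1)) (c′ k) (c′ (minus k 1))
      (+-cancelʳ (+ bit s (toℕ k)) _ _ (trans (eqn k) (sym (eqn′ k)))))
    where
    k : Fin (suc m)
    k = successor j

module CarrySystem (m r a s : ℕ) (a<2ⁿ : a < 2 ^ suc m) (s<2ⁿ : s < 2 ^ suc m) where

  open Cyclic m
  open Congruence M

  fin : ℕ → Fin n
  fin j = j mod n

  toℕ-fin : ∀ {j} → j < n → toℕ (fin j) ≡ j
  toℕ-fin {j} j<n = trans (FinP.toℕ-fromℕ< (m%n<n j n)) (m<n⇒m%n≡m j<n)

  fin-toℕ : ∀ i → fin (toℕ i) ≡ i
  fin-toℕ i = FinP.toℕ-injective (toℕ-fin (FinP.toℕ<n i))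

  shiftedBit : ℕ → ℕ → ℕ
  shiftedBit k j = bit a (toℕ (minus (fin j) k))

  shiftedBit<2 : ∀ k j → shiftedBit k j < 2
  shiftedBit<2 k j = bit<2 a (toℕ (minus (fin j) k))

  a₋₂ᵣ a₋ᵣ : ℕ → ℕ
  a₋₂ᵣ = shiftedBit (2 ℕ.* r)
  a₋ᵣ  = shiftedBit r

  -- Equation (b) reads 2 c_j − c_{j−1} = rhs j.
  rhs : ℕ → ℤ
  rhs j = + a₋₂ᵣ j - + a₋ᵣ j + + bit a j - + bit s j

  bitSum : (ℕ → ℕ) → ℕ → ℤ
  bitSum b L = binSum L (λ j → + b j)

  rhs-linear : ∀ L → binSum L rhs ≡ (bitSum a₋₂ᵣ L + bitSum (bit a) L) - (bitSum a₋ᵣ L + bitSum (bit s) L)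
  rhs-linear L = begin
    binSum L rhs
      ≡⟨ binSum-- L _ _ ⟩
    binSum L (λ j → + a₋₂ᵣ j - + a₋ᵣ j + + bit a j) - S (bit s)
      ≡⟨ cong (_- S (bit s)) (trans (binSum-+ L _ _) (cong (_+ S (bit a)) (binSum-- L _ _))) ⟩
    S a₋₂ᵣ - S a₋ᵣ + S (bit a) - S (bit s)
      ≡⟨ regroup (S a₋₂ᵣ) (S a₋ᵣ) (S (bit a)) (S (bit s)) ⟩
    (S a₋₂ᵣ + S (bit a)) - (S a₋ᵣ + S (bit s)) ∎
    where
    open ≡-Reasoning
    S : (ℕ → ℕ) → ℤ
    S b = bitSum b L
    regroup : ∀ u v x y → u - v + x - y ≡ (u + x) - (v + y)
    regroup = solve-∀

  rhs-split : ∀ L → binSum L rhs ≡ + (binVal L a₋₂ᵣ ℕ.+ binVal L (bit a)) - + (binVal L a₋ᵣ ℕ.+ binVal L (bit s))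
  rhs-split L = trans (rhs-linear L) (cong₂ (λ u v → u - v)
    (cong₂ _+_ (binSum-pos L _) (binSum-pos L _)) (cong₂ _+_ (binSum-pos L _) (binSum-pos L _)))

  binSum-shiftedBit : ∀ k → bitSum (shiftedBit k) n ≈ pow2 k * + a
  binSum-shiftedBit k =
    ≈-trans (binSum-minus k (λ t → + bit a t)) (*-congˡ (pow2 k) (≈-reflexive (binSum-bit n a a<2ⁿ)))

  K-as-ℤ : + (K r ℕ.* a) ≡ (pow2 (2 ℕ.* r) - pow2 r + + 1) * + a
  K-as-ℤ = begin
    + (K r ℕ.* a)                                  ≡⟨ ℤP.pos-* (K r) a ⟩
    + (2 ^ (2 ℕ.* r) ∸ 2 ^ r ℕ.+ 1) * + a          ≡⟨ cong (_* + a) (ℤP.pos-+ (2 ^ (2 ℕ.* r) ∸ 2 ^ r) 1) ⟩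
    (+ (2 ^ (2 ℕ.* r) ∸ 2 ^ r) + + 1) * + a        ≡⟨ cong (λ z → (z + + 1) * + a) (pos-∸ 2^r≤2^2r) ⟩
    (pow2 (2 ℕ.* r) - pow2 r + + 1) * + a ∎
    where
    open ≡-Reasoning
    2^r≤2^2r : 2 ^ r ≤ 2 ^ (2 ℕ.* r)
    2^r≤2^2r = ℕP.^-monoʳ-≤ 2 (ℕP.m≤m+n r (r ℕ.+ 0))

  binSum-rhs≈ : binSum n rhs + + s ≈ + (K r ℕ.* a)
  binSum-rhs≈ = begin
    binSum n rhs + + s
      ≡⟨ cong (_+ + s) (rhs-linear n) ⟩
    ((bitSum a₋₂ᵣ n + bitSum (bit a) n) - (bitSum a₋ᵣ n + bitSum (bit s) n)) + + s
      ≈⟨ +-cong (+-cong (+-cong (binSum-shiftedBit (2 ℕ.* r)) (≈-reflexive (binSum-bit n a a<2ⁿ)))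
                        (neg-cong (+-cong (binSum-shiftedBit r) (≈-reflexive (binSum-bit n s s<2ⁿ)))))
                (≈-reflexive {+ s} refl) ⟩
    ((pow2 (2 ℕ.* r) * + a + + a) - (pow2 r * + a + + s)) + + s
      ≡⟨ regroup (pow2 (2 ℕ.* r)) (pow2 r) (+ a) (+ s) ⟩
    (pow2 (2 ℕ.* r) - pow2 r + + 1) * + a
      ≡⟨ K-as-ℤ ⟨
    + (K r ℕ.* a) ∎
    where
    open ≈-Reasoning
    regroup : ∀ p q a s → ((p * a + a) - (q * a + s)) + s ≡ (p - q + + 1) * a
    regroup = solve-∀

  carry-rhs : ∀ c → Carry n r a s c → ∀ j → j < n → rhs j ≡ + 2 * c (fin j) - c (minus (fin j) 1)
  carry-rhs c (_ , eqn) j j<n = sym (x+z≡y⇒x≡y-z (subst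
    (λ t → + 2 * c (fin j) - c (minus (fin j) 1) + + bit s t ≡ + a₋₂ᵣ j - + a₋ᵣ j + + bit a t)
    (toℕ-fin j<n) (eqn (fin j))))

  binSum-carries≈0 : ∀ (c : Fin n → ℤ) → binSum n (λ j → + 2 * c (fin j) - c (minus (fin j) 1)) ≈ + 0
  binSum-carries≈0 c = begin
    binSum n (λ j → + 2 * c (fin j) - c (minus (fin j) 1))
      ≡⟨ trans (binSum-- n (λ j → + 2 * ĉ j) (λ j → c (minus (fin j) 1)))
               (cong (_- binSum n (λ j → c (minus (fin j) 1))) (binSum-*ˡ n (+ 2) ĉ)) ⟩
    + 2 * binSum n ĉ - binSum n (λ j → c (minus (fin j) 1))
      ≡⟨ cong (λ z → + 2 * binSum n ĉ - z) (binSum-cong n (λ j _ → cong c (fin-toℕ (minus (fin j) 1)))) ⟨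
    + 2 * binSum n ĉ - binSum n (λ j → ĉ (toℕ (minus (fin j) 1)))
      ≈⟨ +-congˡ (+ 2 * binSum n ĉ) (neg-cong (binSum-minus 1 ĉ)) ⟩
    + 2 * binSum n ĉ - + 2 * binSum n ĉ
      ≡⟨ ℤP.+-inverseʳ (+ 2 * binSum n ĉ) ⟩
    + 0 ∎
    where
    open ≈-Reasoning
    ĉ : ℕ → ℤ
    ĉ = c ∘ fin

  carry⇒congK : ∀ c → Carry n r a s c → CongK n r a s
  carry⇒congK c carry = ∣⇒∣ᵤ (_≈_.divisible (begin
    + s
      ≡⟨ ℤP.+-identityˡ (+ s) ⟨
    + 0 + + s
      ≈⟨ +-cong (≈-sym (binSum-carries≈0 c)) (≈-reflexive {+ s} refl) ⟩
    binSum n (λ j → + 2 * c (fin j) - c (minus (fin j) 1)) + + s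
      ≡⟨ cong (_+ + s) (binSum-cong n (carry-rhs c carry)) ⟨
    binSum n rhs + + s
      ≈⟨ binSum-rhs≈ ⟩
    + (K r ℕ.* a) ∎))
    where open ≈-Reasoning

  congK⇒binSum-rhs≈0 : CongK n r a s → binSum n rhs ≈ + 0
  congK⇒binSum-rhs≈0 s∣Ka = begin
    binSum n rhs                  ≡⟨ x+z≡y⇒x≡y-z {z = + s} refl ⟩
    binSum n rhs + + s - + s      ≈⟨ +-cong binSum-rhs≈ (≈-reflexive { - + s} refl) ⟩
    + (K r ℕ.* a) - + s           ≈⟨ +-cong (≈-sym s≈Ka) (≈-reflexive { - + s} refl) ⟩
    + s - + s                     ≡⟨ ℤP.+-inverseʳ (+ s) ⟩
    + 0 ∎
    where
    open ≈-Reasoning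
    s≈Ka : + s ≈ + (K r ℕ.* a)
    s≈Ka = mk≈ (∣ᵤ⇒∣ s∣Ka)

  module Existence (a<2ⁿ-1 : a < 2 ^ n ∸ 1) (s<2ⁿ-1 : s < 2 ^ n ∸ 1)
                   (k : ℤ) (sum≡kM : binSum n rhs ≡ k * M) where

    k-digit : Digit k
    k-digit = digit-from-bounds k B (V₂ ℕ.+ binVal n (bit a)) (V₁ ℕ.+ binVal n (bit s)) kB≡
      (m+n<2*o (≤B (2 ℕ.* r)) (subst (_< B) (sym (binVal-bit n a a<2ⁿ)) a<2ⁿ-1))
      (m+n<2*o (≤B r) (subst (_< B) (sym (binVal-bit n s s<2ⁿ)) s<2ⁿ-1))
      where
      B : ℕ
      B = 2 ^ n ∸ 1
      V₂ V₁ : ℕ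
      V₂ = binVal n a₋₂ᵣ
      V₁ = binVal n a₋ᵣ
      kB≡ : k * + B ≡ + (V₂ ℕ.+ binVal n (bit a)) - + (V₁ ℕ.+ binVal n (bit s))
      kB≡ = trans (cong (k *_) (pos-∸ (ℕP.m^n>0 2 n))) (trans (sym sum≡kM) (rhs-split n))
      ≤B : ∀ t → binVal n (shiftedBit t) ≤ B
      ≤B t = ℕP.∸-monoˡ-≤ 1 (binVal<2^ n (shiftedBit t) (shiftedBit<2 t))

    -- The solution of 2^{j+1} c_j = k + Σ_{l≤j} rhs_l 2^l, written without division.
    carry : ℕ → ℤ
    carry j = k * pow2 (n ∸ suc j) - binSum (n ∸ suc j) (λ l → rhs (suc j ℕ.+ l))

    carry-scaled : ∀ j → j < n → pow2 (suc j) * carry j ≡ k + binSum (suc j) rhs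
    carry-scaled j j<n = begin
      P * (k * pow2 d - T)                           ≡⟨ expand P (pow2 d) T k ⟩
      k * (P * pow2 d - + 1) + k - P * T             ≡⟨ cong (λ z → k * (z - + 1) + k - P * T) P*2ᵈ≡2ⁿ ⟩
      k * M + k - P * T                              ≡⟨ cong (λ z → z + k - P * T) sum≡kM ⟨
      binSum n rhs + k - P * T                       ≡⟨ cong (λ z → z + k - P * T) split ⟩
      binSum (suc j) rhs + P * T + k - P * T         ≡⟨ cancel (binSum (suc j) rhs) (P * T) k ⟩
      k + binSum (suc j) rhs ∎
      where
      open ≡-Reasoning
      d : ℕ
      d = n ∸ suc j
      P : ℤ
      P = pow2 (suc j)
      T : ℤ
      T = binSum d (λ l → rhs (suc j ℕ.+ l))
      1+j+d≡n : suc j ℕ.+ d ≡ n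
      1+j+d≡n = ℕP.m+[n∸m]≡n j<n
      P*2ᵈ≡2ⁿ : P * pow2 d ≡ pow2 n
      P*2ᵈ≡2ⁿ = trans (sym (pow2-+ (suc j) d)) (cong pow2 1+j+d≡n)
      split : binSum n rhs ≡ binSum (suc j) rhs + P * T
      split = trans (cong (λ L → binSum L rhs) (sym 1+j+d≡n)) (binSum-split (suc j) d rhs)
      expand : ∀ P Q T k → P * (k * Q - T) ≡ k * (P * Q - + 1) + k - P * T
      expand = solve-∀
      cancel : ∀ S U k → S + U + k - U ≡ k + S
      cancel = solve-∀

    carry-digit : ∀ j → j < n → Digit (carry j)
    carry-digit j j<n = digit-from-offset k (carry j) (2 ^ suc j) P N k-digit
      (m+n<2*o (binVal<2^ (suc j) _ (shiftedBit<2 (2 ℕ.* r))) (binVal<2^ (suc j) (bit a) (bit<2 a)))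
      (m+n<2*o (binVal<2^ (suc j) _ (shiftedBit<2 r)) (binVal<2^ (suc j) (bit s) (bit<2 s)))
      (trans (ℤP.*-comm (carry j) (pow2 (suc j)))
             (trans (carry-scaled j j<n) (cong (λ z → k + z) (rhs-split (suc j)))))
      where
      P N : ℕ
      P = binVal (suc j) a₋₂ᵣ ℕ.+ binVal (suc j) (bit a)
      N = binVal (suc j) a₋ᵣ ℕ.+ binVal (suc j) (bit s)

    carry-last : carry m ≡ k
    carry-last = begin
      k * pow2 (m ∸ m) - binSum (m ∸ m) (λ l → rhs (suc m ℕ.+ l))
        ≡⟨ cong (λ d → k * pow2 d - binSum d (λ l → rhs (suc m ℕ.+ l))) (ℕP.n∸n≡0 m) ⟩
      k * + 1 - + 0
        ≡⟨ trans (ℤP.+-identityʳ (k * + 1)) (ℤP.*-identityʳ k) ⟩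
      k ∎
      where open ≡-Reasoning

    carry-equation : ∀ j → j < n → + 2 * carry j - carry ((j ℕ.+ m) % n) ≡ rhs j
    carry-equation zero    j<n = begin
      + 2 * carry 0 - carry (m % n)   ≡⟨ cong (λ i → + 2 * carry 0 - carry i) (m<n⇒m%n≡m (ℕP.n<1+n m)) ⟩
      + 2 * carry 0 - carry m         ≡⟨ cong₂ _-_ (carry-scaled 0 j<n) carry-last ⟩
      k + (rhs 0 + + 2 * + 0) - k     ≡⟨ cancel k (rhs 0) ⟩
      rhs 0 ∎
      where
      open ≡-Reasoning
      cancel : ∀ k x → k + (x + + 2 * + 0) - k ≡ x
      cancel = solve-∀
    carry-equation (suc j) 1+j<n = ℤP.*-cancelˡ-≡ P _ _ {{ℕP.m^n≢0 2 (suc j)}} (begin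
      P * (+ 2 * carry (suc j) - carry ((suc j ℕ.+ m) % n))
        ≡⟨ cong (λ i → P * (+ 2 * carry (suc j) - carry i)) ([1+j+m]%n≡j j j<n) ⟩
      P * (+ 2 * carry (suc j) - carry j)
        ≡⟨ distrib P (carry (suc j)) (carry j) ⟩
      (+ 2 * P) * carry (suc j) - P * carry j
        ≡⟨ cong (λ z → z * carry (suc j) - P * carry j) (pow2-suc (suc j)) ⟨
      pow2 (suc (suc j)) * carry (suc j) - P * carry j
        ≡⟨ cong₂ _-_ (carry-scaled (suc j) 1+j<n) (carry-scaled j j<n) ⟩
      k + binSum (suc (suc j)) rhs - (k + binSum (suc j) rhs)
        ≡⟨ cong (λ z → k + z - (k + binSum (suc j) rhs)) (binSum-last (suc j) rhs) ⟩
      k + (binSum (suc j) rhs + P * rhs (suc j)) - (k + binSum (suc j) rhs)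
        ≡⟨ cancel k (binSum (suc j) rhs) (P * rhs (suc j)) ⟩
      P * rhs (suc j) ∎)
      where
      open ≡-Reasoning
      P : ℤ
      P = pow2 (suc j)
      j<n : j < n
      j<n = ℕP.<-trans (ℕP.n<1+n j) 1+j<n
      distrib : ∀ P x y → P * (+ 2 * x - y) ≡ (+ 2 * P) * x - P * y
      distrib = solve-∀
      cancel : ∀ k S u → k + (S + u) - (k + S) ≡ u
      cancel = solve-∀

    carries : Fin n → ℤ
    carries i = carry (toℕ i)

    carries-Carry : Carry n r a s carries
    carries-Carry = (λ i → carry-digit (toℕ i) (FinP.toℕ<n i)) , equation
      where
      equation : ∀ i → + 2 * carries i - carries (minus i 1) + + bit s (toℕ i)
                       ≡ + bit a (toℕ (minus i (2 ℕ.* r))) - + bit a (toℕ (minus i r)) + + bit a (toℕ i)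
      equation i = begin
        + 2 * carries i - carries (minus i 1) + + bit s (toℕ i)
          ≡⟨ cong (λ t → + 2 * carries i - carry t + + bit s (toℕ i)) (toℕ-minus-1 m i) ⟩
        + 2 * carry (toℕ i) - carry ((toℕ i ℕ.+ m) % n) + + bit s (toℕ i)
          ≡⟨ x≡y-z⇒x+z≡y (carry-equation (toℕ i) (FinP.toℕ<n i)) ⟩
        + a₋₂ᵣ (toℕ i) - + a₋ᵣ (toℕ i) + + bit a (toℕ i)
          ≡⟨ cong (λ i′ → + bit a (toℕ (minus i′ (2 ℕ.* r))) - + bit a (toℕ (minus i′ r)) + + bit a (toℕ i))
                  (fin-toℕ i) ⟩
        + bit a (toℕ (minus i (2 ℕ.* r))) - + bit a (toℕ (minus i r)) + + bit a (toℕ i) ∎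
        where open ≡-Reasoning

  congK⇒carry : a < 2 ^ n ∸ 1 → s < 2 ^ n ∸ 1 → CongK n r a s → ∃ (Carry n r a s)
  congK⇒carry a<2ⁿ-1 s<2ⁿ-1 s∣Ka = carries , carries-Carry
    where
    open Signed._∣_ (_≈_.divisible (congK⇒binSum-rhs≈0 s∣Ka)) renaming (quotient to k)
    sum≡kM : binSum n rhs ≡ k * M
    sum≡kM = trans (sym (ℤP.+-identityʳ (binSum n rhs))) equality
    open Existence a<2ⁿ-1 s<2ⁿ-1 k sum≡kM

theorem5 : (n r : ℕ) .{{_ : NonZero n}} → 1 ≤ r → (a s : ℕ) →
           1 ≤ a → a ≤ 2 ^ n ∸ 2 → 1 ≤ s → s ≤ 2 ^ n ∸ 2 →
           (CongK n r a s ⇔ ∃ (λ (c : Fin n → ℤ) → Carry n r a s c))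
           × (∀ (c c′ : Fin n → ℤ) → Carry n r a s c → Carry n r a s c′ → ∀ i → c i ≡ c′ i)
theorem5 zero    r _ a s 1≤a a≤0 _ _    = ⊥-elim (ℕP.<⇒≱ 1≤a a≤0)
theorem5 (suc m) r _ a s _   a≤  _ s≤ =
  mk⇔ (congK⇒carry a<2ⁿ-1 s<2ⁿ-1) (λ (c , carry) → carry⇒congK c carry) , carry-unique m r a s
  where
  2≤2ⁿ : 2 ≤ 2 ^ suc m
  2≤2ⁿ = ℕP.*-monoʳ-≤ 2 (ℕP.m^n>0 2 m)
  ≤2ⁿ-2⇒<2ⁿ-1 : ∀ {x} → x ≤ 2 ^ suc m ∸ 2 → x < 2 ^ suc m ∸ 1
  ≤2ⁿ-2⇒<2ⁿ-1 x≤ = ℕP.≤-trans (s≤s x≤) (ℕP.≤-reflexive (sym (ℕP.+-∸-assoc 1 2≤2ⁿ)))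
  a<2ⁿ-1 : a < 2 ^ suc m ∸ 1
  a<2ⁿ-1 = ≤2ⁿ-2⇒<2ⁿ-1 a≤
  s<2ⁿ-1 : s < 2 ^ suc m ∸ 1
  s<2ⁿ-1 = ≤2ⁿ-2⇒<2ⁿ-1 s≤
  2ⁿ-1<2ⁿ : 2 ^ suc m ∸ 1 < 2 ^ suc m
  2ⁿ-1<2ⁿ = ℕP.∸-monoʳ-< (s≤s z≤n) (ℕP.m^n>0 2 (suc m))
  open CarrySystem m r a s (ℕP.<-trans a<2ⁿ-1 2ⁿ-1<2ⁿ) (ℕP.<-trans s<2ⁿ-1 2ⁿ-1<2ⁿ)
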